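{- Let $\langle sv,frm\rangle$ and $\langle sv',frm'\rangle$ be structural abstract substitutions over the same domain $D=\{x_1,\dots,x_n\}$ with index sets $I$ and $I'$ respectively, and let $im:I\to I'$ be a total function such that $\langle sv',frm'\rangle$ is an instance of $\langle sv,frm\rangle$ with respect to $im$. Let $\theta\in Cc\langle sv,frm\rangle$, $\theta'\in Cc\langle sv',frm'\rangle$ and $\sigma$ a standard substitution, and let $(t_i)_{i\in I}$ and $(t'_i)_{i\in I'}$ be the decompositions of $\theta$ and $\theta'$ with respect to $\langle sv,frm\rangle$ and $\langle sv',frm'\rangle$. If $\theta'=\theta\sigma$, then $(t_i\sigma)_{i\in I}=(t'_{im(i)})_{i\in I}$, i.e. $t_i\sigma=t'_{im(i)}$ for all $i\in I$.
   Context: Terms are first-order terms built from functors and standard variables; a standard substitution $\sigma$ is a usual substitution on standard variables. A program substitution $\theta=\{x_1/s_1,\dots,x_n/s_n\}$ over domain $D=\{x_1,\dots,x_n\}$ (program variables) maps each $x_j$ to a term $x_j\theta=s_j$, and $\theta\sigma=\{x_1/s_1\sigma,\dots,x_n/s_n\sigma\}$. Let $I$ be a finite set of indices. A pattern over $I$ is an expression $f(i_1,\dots,i_k)$ with $f$ a functor of arity $k$ and $i_1,\dots,i_k\in I$. A pattern component is a partial function $frm:I\rightharpoonup\{\text{patterns over } I\}$; it induces the relation $i\succ j$ iff $frm(i)$ is of the form $f(\dots,j,\dots)$, which is required to be well-founded. $Cc(frm)$ is the set of families of terms $(t_i)_{i\in I}$ such that $frm(i)=f(i_1,\dots,i_k)$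 implies $t_i=f(t_{i_1},\dots,t_{i_k})$. A structural abstract substitution over domain $D$ and index set $I$ is a pair $\langle sv,frm\rangle$ with $sv:D\to I$ total and $frm$ a pattern component over $I$, where moreover every $i\in I$ is reachable: there are $x_j\in D$ and $i_1,\dots,i_k$ with $i_1=sv(x_j)$, $i_1\succ\dots\succ i_k$, $i_k=i$. $Cc\langle sv,frm\rangle$ is the set of program substitutions $\theta$ over $D$ for which some $(t_i)_{i\in I}\in Cc(frm)$ satisfies $x_j\theta=t_{sv(x_j)}$ for all $x_j\in D$. For $\theta\in Cc\langle sv,frm\rangle$, its decomposition with respect to $\langle sv,frm\rangle$ is the unique family $(t_i)_{i\in I}\in Cc(frm)$ with $\theta=\{x_1/t_{sv(x_1)},\dots,x_n/t_{sv(x_n)}\}$. Given structural abstract substitutions $\langle sv,frm\rangle$ (index set $I$) and $\langle sv',frm'\rangle$ (index set $I'$) over the same domain and a total $im:I\to I'$, $\langle sv',frm'\rangle$ is an instance of $\langle sv,frm\rangle$ with respect to $im$ iff $sv'=im\circ sv$ and, for all $i,i_1,\dots,i_m\in I$, $frm(i)=f(i_1,\dots,i_m)$ implies $frm'(im(i))=f(im(i_1),\dots,im(i_m))$. -}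

module Defs where

open import Data.Nat using (ℕ)
open import Data.Fin using (Fin)
open import Data.Vec using (Vec; []; _∷_)
import Data.Vec as Vec
open import Data.Vec.Membership.Propositional using (_∈_)
open import Data.Maybe using (Maybe; just; nothing)
open import Data.Product using (Σ; ∃; ∃-syntax; _×_; _,_)
open import Relation.Binary.PropositionalEquality using (_≡_)
open import Relation.Binary.Construct.Closure.ReflexiveTransitive using (Star)
open import Induction.WellFounded using (WellFounded)

record Signature : Set₁ where
  field
    Functor : Set
    arity   : Functor → ℕ
open Signature public

data Term (S : Signature) (V : Set) : Set where
  var : V → Term S V
  fun : (f : Functor S) → Vec (Term S V) (arity S f) → Term S V

StdSubst : Signature → Set → Set
StdSubst S V = V → Term S V

mutual
  _⟨_⟩ : {S : Signature} {V : Set} → Term S V → StdSubst S V → Term S V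
  var v    ⟨ σ ⟩ = σ v
  fun f ts ⟨ σ ⟩ = fun f (applyVec ts σ)

  applyVec : {S : Signature} {V : Set} {k : ℕ} →
             Vec (Term S V) k → StdSubst S V → Vec (Term S V) k
  applyVec []       σ = []
  applyVec (t ∷ ts) σ = (t ⟨ σ ⟩) ∷ applyVec ts σ

-- Program substitutions over the domain D = {x_1,…,x_n} (represented by Fin n).
ProgSubst : Signature → Set → ℕ → Set
ProgSubst S V n = Fin n → Term S V

_∘ₛ_ : {S : Signature} {V : Set} {n : ℕ} → ProgSubst S V n → StdSubst S V → ProgSubst S V n
(θ ∘ₛ σ) x = θ x ⟨ σ ⟩

-- Patterns over the index set I = Fin m: f(i_1,…,i_k).
Pattern : Signature → ℕ → Set
Pattern S m = Σ (Functor S) (λ f → Vec (Fin m) (arity S f))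

PatComp : Signature → ℕ → Set
PatComp S m = Fin m → Maybe (Pattern S m)

_⊢_≻_ : {S : Signature} {m : ℕ} → PatComp S m → Fin m → Fin m → Set
frm ⊢ i ≻ j = ∃[ f ] ∃[ is ] (frm i ≡ just (f , is) × j ∈ is)

WellFoundedPC : {S : Signature} {m : ℕ} → PatComp S m → Set
WellFoundedPC frm = WellFounded (λ j i → frm ⊢ i ≻ j)

InCcFrm : {S : Signature} {V : Set} {m : ℕ} → PatComp S m → (Fin m → Term S V) → Set
InCcFrm {S} {V} {m} frm t =
  (i : Fin m) (f : Functor S) (is : Vec (Fin m) (arity S f)) →
  frm i ≡ just (f , is) → t i ≡ fun f (Vec.map t is)

record StructAbsSubst (S : Signature) (n m : ℕ) : Set where
  field
    sv        : Fin n → Fin m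
    frm       : PatComp S m
    wf        : WellFoundedPC frm
    reachable : (i : Fin m) → ∃[ x ] Star (frm ⊢_≻_) (sv x) i
open StructAbsSubst public

-- (t_i) ∈ Cc(frm) with θ = {x_j / t_{sv(x_j)}} ; i.e. (t_i) is the decomposition of θ
-- (in particular θ ∈ Cc⟨sv,frm⟩).
IsDecomposition : {S : Signature} {V : Set} {n m : ℕ} →
                  StructAbsSubst S n m → ProgSubst S V n → (Fin m → Term S V) → Set
IsDecomposition A θ t = InCcFrm (frm A) t × (∀ x → θ x ≡ t (sv A x))

IsInstance : {S : Signature} {n m m' : ℕ} →
             StructAbsSubst S n m' → StructAbsSubst S n m → (Fin m → Fin m') → Set
IsInstance {S} {n} {m} A' A im =
  (∀ x → sv A' x ≡ im (sv A x)) ×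
  (∀ (i : Fin m) (f : Functor S) (is : Vec (Fin m) (arity S f)) →
     frm A i ≡ just (f , is) → frm A' (im i) ≡ just (f , Vec.map im is))

-- Every index is reachable from some sv x, and the agreement t i σ = t' (im i)
-- holds at each sv x (because θ' = θσ) and is inherited by the sons of an index
-- (because im maps the pattern of i to the pattern of im i and functors are injective).

module Submission where

open import Defs
open import Data.Nat using (ℕ)
open import Data.Fin using (Fin)
open import Data.Vec using (Vec; []; _∷_)
import Data.Vec as Vec
open import Data.Vec.Properties using (map-∘)
open import Data.Vec.Membership.Propositional using (_∈_)
open import Data.Vec.Relation.Unary.Any using (here; there)
open import Data.Product using (_,_)
open import Relation.Binary.PropositionalEquality
open import Relation.Binary.Construct.Closure.ReflexiveTransitive using (Star; ε; _◅_)

fun-injective : ∀ {S V} {f : Functor S} {ts us : Vec (Term S V) (arity S f)} →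
                fun f ts ≡ fun f us → ts ≡ us
fun-injective refl = refl

applyVec-map-∈ : ∀ {S V} {A : Set} {k} (σ : StdSubst S V)
                 (t u : A → Term S V) (is : Vec A k) {j : A} →
                 applyVec (Vec.map t is) σ ≡ Vec.map u is →
                 j ∈ is → t j ⟨ σ ⟩ ≡ u j
applyVec-map-∈ σ t u (i ∷ is) eq (here refl) = cong Vec.head eq
applyVec-map-∈ σ t u (i ∷ is) eq (there j∈is) =
  applyVec-map-∈ σ t u is (cong Vec.tail eq) j∈is

star-preserves : ∀ {I : Set} {_⟶_ : I → I → Set} (P : I → Set) →
                 (∀ {i j} → i ⟶ j → P i → P j) →
                 ∀ {i j} → Star _⟶_ i j → P i → P j
star-preserves P step ε         p = p
star-preserves P step (r ◅ rs) p = star-preserves P step rs (step r p)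

module Agreement {S : Signature} {V : Set} {n m m' : ℕ}
         (A : StructAbsSubst S n m) (A' : StructAbsSubst S n m')
         (im : Fin m → Fin m') (σ : StdSubst S V)
         (t : Fin m → Term S V) (t' : Fin m' → Term S V) where

  InstanceAt : Fin m → Set
  InstanceAt i = t i ⟨ σ ⟩ ≡ t' (im i)

  instanceAt-son : IsInstance A' A im → InCcFrm (frm A) t → InCcFrm (frm A') t' →
                   ∀ {i j} → frm A ⊢ i ≻ j → InstanceAt i → InstanceAt j
  instanceAt-son (_ , frm≤) cc cc' {i} (f , is , frm-i , j∈is) ti≡ =
    applyVec-map-∈ σ t (λ k → t' (im k)) is sons≡ j∈is
    where
    sons≡ : applyVec (Vec.map t is) σ ≡ Vec.map (λ k → t' (im k)) is
    sons≡ = fun-injective (begin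
      fun f (applyVec (Vec.map t is) σ)  ≡⟨ cong (_⟨ σ ⟩) (cc i f is frm-i) ⟨
      t i ⟨ σ ⟩                          ≡⟨ ti≡ ⟩
      t' (im i)                          ≡⟨ cc' (im i) f (Vec.map im is) (frm≤ i f is frm-i) ⟩
      fun f (Vec.map t' (Vec.map im is)) ≡⟨ cong (fun f) (map-∘ t' im is) ⟨
      fun f (Vec.map (λ k → t' (im k)) is) ∎)
      where open ≡-Reasoning

  instanceAt-sv : IsInstance A' A im → (θ θ' : ProgSubst S V n) →
                  (∀ x → θ x ≡ t (sv A x)) → (∀ x → θ' x ≡ t' (sv A' x)) →
                  (∀ x → θ' x ≡ (θ ∘ₛ σ) x) → ∀ x → InstanceAt (sv A x)
  instanceAt-sv (sv≡ , _) θ θ' θ≡ θ'≡ θ'≡θσ x = begin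
    t (sv A x) ⟨ σ ⟩ ≡⟨ cong (_⟨ σ ⟩) (θ≡ x) ⟨
    θ x ⟨ σ ⟩        ≡⟨ θ'≡θσ x ⟨
    θ' x             ≡⟨ θ'≡ x ⟩
    t' (sv A' x)     ≡⟨ cong t' (sv≡ x) ⟩
    t' (im (sv A x)) ∎
    where open ≡-Reasoning

mainTheorem10 : (S : Signature) (V : Set) (n m m' : ℕ)
    (A : StructAbsSubst S n m) (A' : StructAbsSubst S n m')
    (im : Fin m → Fin m') → IsInstance A' A im →
    (θ θ' : ProgSubst S V n) (σ : StdSubst S V)
    (t : Fin m → Term S V) (t' : Fin m' → Term S V) →
    IsDecomposition A θ t → IsDecomposition A' θ' t' →
    (∀ x → θ' x ≡ (θ ∘ₛ σ) x) →
    ∀ i → t i ⟨ σ ⟩ ≡ t' (im i)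
mainTheorem10 S V n m m' A A' im inst θ θ' σ t t' (cc , θ≡) (cc' , θ'≡) θ'≡θσ i
  with reachable A i
... | x , path =
  star-preserves InstanceAt (instanceAt-son inst cc cc') path
    (instanceAt-sv inst θ θ' θ≡ θ'≡ θ'≡θσ x)
  where open Agreement A A' im σ t t'
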